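{- Let $\mu\geq 1$ be an integer. Then for every integer $j\geq 1$, the 2-adic valuation (the exponent of the exact power of $2$ dividing) of the integer \[\prod_{r=j}^{j+2^\mu-1}r\;\sum_{s=j}^{j+2^\mu-1}\frac{1}{s}\] equals $2^\mu-\mu-1$, independently of $j$. -}

module Defs where

open import Data.Nat using (ℕ; suc; _+_; _^_)
open import Data.Nat.Divisibility using (_∣_)
open import Data.Integer using (+_)
open import Data.List using (List; map; upTo; foldr)
open import Data.Product using (_×_)
open import Relation.Nullary using (¬_)
open import Data.Rational.Unnormalised as Q using (ℚᵘ; _/_; 0ℚᵘ; 1ℚᵘ)

-- ∏_{r=j}^{j+len-1} r · ∑_{s=j}^{j+len-1} 1/s   for j = suc j' ≥ 1,
-- computed in the (unnormalised) rationals.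
-- Elements of the range are  suc (j' + i)  for i = 0, …, len-1.
prodRange : ℕ → ℕ → ℚᵘ
prodRange j' len = foldr (λ i acc → ((+ suc (j' + i)) / 1) Q.* acc) 1ℚᵘ (upTo len)

harmRange : ℕ → ℕ → ℚᵘ
harmRange j' len = foldr (λ i acc → ((+ 1) / suc (j' + i)) Q.+ acc) 0ℚᵘ (upTo len)

Q-quantity : ℕ → ℕ → ℚᵘ
Q-quantity j' len = prodRange j' len Q.* harmRange j' len

Val2≡ : ℕ → ℕ → Set
Val2≡ N v = (2 ^ v ∣ N) × ¬ (2 ^ (v + 1) ∣ N)

{-# OPTIONS --safe #-}
-- Write j' = q 2^μ + r with r < 2^μ. Among j'+1, …, j'+2^μ only 2^μ (q+1) is divisible by 2^μ,
-- and ∏ r ∑ 1/s = ∑_s ∏_{r≠s} r. The summand omitting 2^μ (q+1) has 2-adic valuation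
-- e(μ) = 2^μ − μ − 1 and every other summand a larger one. By induction on μ: a window of length
-- 2^(μ+1) is two windows of length 2^μ whose distinguished multiples are 2^μ c and 2^μ (c+1);
-- exactly one of c, c+1 is odd, which gives e(μ+1) = 2 e(μ) + μ and keeps the odd parts odd.
module Submission where

open import Defs
open import Function using (_∘_)
open import Data.Nat using (ℕ; zero; suc; _+_; _*_; _^_; _∸_; _<_; _≥_; _<?_; s≤s; NonZero)
open import Data.Nat.Properties
open import Data.Nat.Tactic.RingSolver
open import Data.Nat.Divisibility
  using (_∣_; _∤_; divides; ∣m+n∣m⇒∣n; m∣m*n; ∣m⇒∣m*n; ∣n⇒∣m*n; ∣1⇒≡1; *-cancelˡ-∣)
open import Data.Nat.DivMod using (m≡m%n+[m/n]*n; m%n<n) renaming (_/_ to _div_)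
open import Data.Nat.Primality using (Prime; euclidsLemma; prime[2])
open import Data.Nat.ListAction using (product)
open import Data.Nat.ListAction.Properties using (product-++)
open import Data.Integer using (+_)
import Data.Integer as ℤ
import Data.Integer.Properties as ℤ
import Data.Integer.Tactic.RingSolver as ℤ-Solver
open import Data.List using (List; []; _∷_; _++_; foldr; map; applyUpTo; upTo)
open import Data.List.Properties using (foldr-map; map-upTo; map-++)
open import Data.Product using (Σ; Σ-syntax; _×_; _,_)
open import Data.Sum using (_⊎_; inj₁; inj₂)
open import Data.Rational.Unnormalised as ℚ using (ℚᵘ; _/_; _≃_; *≡*; 0ℚᵘ; 1ℚᵘ)
open import Data.Rational.Unnormalised.Properties
  using (≃-refl; ≃-reflexive; ≃-trans; *-inverseʳ; *-congˡ; *-congʳ; +-cong; module ≃-Reasoning)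
import Data.Rational.Unnormalised.Properties as ℚ
open import Relation.Binary.PropositionalEquality
open import Relation.Nullary using (yes; no; contradiction)

∤-+-∣ : ∀ {d m n} → d ∤ m → d ∣ n → d ∤ m + n
∤-+-∣ {d} {m} {n} d∤m d∣n d∣m+n = d∤m (∣m+n∣m⇒∣n (subst (d ∣_) (+-comm m n) d∣m+n) d∣n)

∣-+-∤ : ∀ {d m n} → d ∣ m → d ∤ n → d ∤ m + n
∣-+-∤ d∣m d∤n d∣m+n = d∤n (∣m+n∣m⇒∣n d∣m+n d∣m)

prime-∤-* : ∀ {p m n} → Prime p → p ∤ m → p ∤ n → p ∤ m * n
prime-∤-* {m = m} {n} pp p∤m p∤n p∣m*n with euclidsLemma m n pp p∣m*n
... | inj₁ p∣m = p∤m p∣m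
... | inj₂ p∣n = p∤n p∣n

2∤1 : 2 ∤ 1
2∤1 2∣1 = contradiction (∣1⇒≡1 2∣1) λ ()

2∤2n+1 : ∀ n → 2 ∤ suc (2 * n)
2∤2n+1 n = subst (2 ∤_) (+-comm (2 * n) 1) (∣-+-∤ (m∣m*n n) 2∤1)

2∣2n+2 : ∀ n → 2 ∣ suc (suc (2 * n))
2∣2n+2 n = divides (suc n) (2n+2≡[n+1]*2 n)
  where
  2n+2≡[n+1]*2 : ∀ n → suc (suc (2 * n)) ≡ suc n * 2
  2n+2≡[n+1]*2 = solve-∀

Val2≡-2^v*odd : ∀ v {u} → 2 ∤ u → Val2≡ (2 ^ v * u) v
Val2≡-2^v*odd v {u} 2∤u = m∣m*n u , λ 2^[v+1]∣ →
  2∤u (*-cancelˡ-∣ (2 ^ v) (subst (_∣ 2 ^ v * u) (^-distribˡ-+-* 2 v 1) 2^[v+1]∣))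
  where
  instance
    2^v≢0 : NonZero (2 ^ v)
    2^v≢0 = m^n≢0 2 v

-- A list ms stands for the positive integers suc m, m ∈ ms, as in prodRange and harmRange;
-- harmNum ms is the numerator ∑_s ∏_{r ≠ s} r of ∏ r · ∑ 1/s.
productSuc : List ℕ → ℕ
productSuc ms = product (map suc ms)

harmNum : List ℕ → ℕ
harmNum []       = 0
harmNum (m ∷ ms) = productSuc ms + suc m * harmNum ms

productSuc-++ : ∀ ms ns → productSuc (ms ++ ns) ≡ productSuc ms * productSuc ns
productSuc-++ ms ns = trans (cong product (map-++ suc ms ns)) (product-++ (map suc ms) (map suc ns))

harmNum-++ : ∀ ms ns → harmNum (ms ++ ns) ≡ harmNum ms * productSuc ns + productSuc ms * harmNum ns
harmNum-++ []       ns = sym (+-identityʳ (harmNum ns))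
harmNum-++ (m ∷ ms) ns rewrite harmNum-++ ms ns | productSuc-++ ms ns =
  distribute (suc m) (productSuc ms) (harmNum ms) (productSuc ns) (harmNum ns)
  where
  distribute : ∀ x p h p′ h′ → p * p′ + x * (h * p′ + p * h′) ≡ (p + x * h) * p′ + x * p * h′
  distribute = solve-∀

ι : ℕ → ℚᵘ
ι n = + n / 1

ι-+ : ∀ m n → ι m ℚ.+ ι n ≃ ι (m + n)
ι-+ m n = *≡* (trans (normalise (+ m) (+ n)) (cong (ℤ._* + 1) (sym (ℤ.pos-+ m n))))
  where
  normalise : ∀ a b → (a ℤ.* + 1 ℤ.+ b ℤ.* + 1) ℤ.* + 1 ≡ (a ℤ.+ b) ℤ.* + 1
  normalise = ℤ-Solver.solve-∀

ι-* : ∀ m n → ι m ℚ.* ι n ≃ ι (m * n)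
ι-* m n = *≡* (cong (ℤ._* + 1) (sym (ℤ.pos-* m n)))

prodQ : List ℕ → ℚᵘ
prodQ = foldr (λ m acc → ι (suc m) ℚ.* acc) 1ℚᵘ

harmQ : List ℕ → ℚᵘ
harmQ = foldr (λ m acc → (+ 1 / suc m) ℚ.+ acc) 0ℚᵘ

prodQ≃productSuc : ∀ ms → prodQ ms ≃ ι (productSuc ms)
prodQ≃productSuc []       = ≃-refl
prodQ≃productSuc (m ∷ ms) =
  ≃-trans (*-congˡ {ι (suc m)} (prodQ≃productSuc ms)) (ι-* (suc m) (productSuc ms))

prodQ*harmQ≃harmNum : ∀ ms → prodQ ms ℚ.* harmQ ms ≃ ι (harmNum ms)
prodQ*harmQ≃harmNum []       = ≃-refl
prodQ*harmQ≃harmNum (m ∷ ms) = begin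
  (x ℚ.* P) ℚ.* (x⁻¹ ℚ.+ H)               ≈⟨ ℚ.*-distribˡ-+ (x ℚ.* P) x⁻¹ H ⟩
  (x ℚ.* P) ℚ.* x⁻¹ ℚ.+ (x ℚ.* P) ℚ.* H   ≈⟨ +-cong cancel (ℚ.*-assoc x P H) ⟩
  P ℚ.+ x ℚ.* (P ℚ.* H)
    ≈⟨ +-cong (prodQ≃productSuc ms) (*-congˡ {x} (prodQ*harmQ≃harmNum ms)) ⟩
  ι (productSuc ms) ℚ.+ x ℚ.* ι (harmNum ms)
    ≈⟨ +-cong (≃-refl {ι (productSuc ms)}) (ι-* (suc m) (harmNum ms)) ⟩
  ι (productSuc ms) ℚ.+ ι (suc m * harmNum ms)
    ≈⟨ ι-+ (productSuc ms) (suc m * harmNum ms) ⟩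
  ι (harmNum (m ∷ ms))                     ∎
  where
  open ≃-Reasoning
  x x⁻¹ P H : ℚᵘ
  x = ι (suc m)
  x⁻¹ = + 1 / suc m
  P = prodQ ms
  H = harmQ ms
  cancel : (x ℚ.* P) ℚ.* x⁻¹ ≃ P
  cancel = begin
    (x ℚ.* P) ℚ.* x⁻¹ ≈⟨ *-congʳ (ℚ.*-comm x P) ⟩
    (P ℚ.* x) ℚ.* x⁻¹ ≈⟨ ℚ.*-assoc P x x⁻¹ ⟩
    P ℚ.* (x ℚ.* x⁻¹) ≈⟨ *-congˡ {P} (*-inverseʳ x) ⟩
    P ℚ.* 1ℚᵘ         ≈⟨ ℚ.*-identityʳ P ⟩
    P                 ∎

-- Stands for the integers j' + 1, …, j' + n.
window : ℕ → ℕ → List ℕ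
window j' n = applyUpTo (_+_ j') n

foldr-upTo-shift : ∀ {B : Set} (f : ℕ → B → B) e j' n →
                   foldr (λ i → f (j' + i)) e (upTo n) ≡ foldr f e (window j' n)
foldr-upTo-shift f e j' n =
  trans (sym (foldr-map f (_+_ j') e (upTo n))) (cong (foldr f e) (map-upTo (_+_ j') n))

Q-quantity≡ : ∀ j' n → Q-quantity j' n ≡ prodQ (window j' n) ℚ.* harmQ (window j' n)
Q-quantity≡ j' n = cong₂ ℚ._*_ (foldr-upTo-shift _ 1ℚᵘ j' n) (foldr-upTo-shift _ 0ℚᵘ j' n)

applyUpTo-++ : ∀ {A : Set} (f : ℕ → A) m n →
               applyUpTo f (m + n) ≡ applyUpTo f m ++ applyUpTo (f ∘ (_+_ m)) n
applyUpTo-++ f zero    n = refl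
applyUpTo-++ f (suc m) n = cong (f 0 ∷_) (applyUpTo-++ (f ∘ suc) m n)

applyUpTo-cong : ∀ {A : Set} {f g : ℕ → A} → (∀ i → f i ≡ g i) →
                 ∀ n → applyUpTo f n ≡ applyUpTo g n
applyUpTo-cong f≗g zero    = refl
applyUpTo-cong f≗g (suc n) = cong₂ _∷_ (f≗g 0) (applyUpTo-cong (f≗g ∘ suc) n)

window-++ : ∀ j' m n → window j' (m + n) ≡ window j' m ++ window (j' + m) n
window-++ j' m n = trans (applyUpTo-++ (_+_ j') m n)
                         (cong (window j' m ++_) (applyUpTo-cong (λ i → sym (+-assoc j' m i)) n))

window-double : ∀ j' n → window j' (2 * n) ≡ window j' n ++ window (j' + n) n
window-double j' n = trans (cong (λ k → window j' (n + k)) (+-identityʳ n)) (window-++ j' n n)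

windowExponent : ℕ → ℕ
windowExponent zero    = 0
windowExponent (suc μ) = windowExponent μ + windowExponent μ + μ

windowExponent+μ+1≡2^μ : ∀ μ → windowExponent μ + (μ + 1) ≡ 2 ^ μ
windowExponent+μ+1≡2^μ zero    = refl
windowExponent+μ+1≡2^μ (suc μ) =
  trans (regroup (windowExponent μ) μ) (cong (λ t → t + (t + 0)) (windowExponent+μ+1≡2^μ μ))
  where
  regroup : ∀ e m → e + e + m + (suc m + 1) ≡ e + (m + 1) + (e + (m + 1) + 0)
  regroup = solve-∀

windowExponent≡2^μ∸μ∸1 : ∀ μ → windowExponent μ ≡ 2 ^ μ ∸ μ ∸ 1
windowExponent≡2^μ∸μ∸1 μ = begin
  windowExponent μ                         ≡⟨ m+n∸n≡m (windowExponent μ) (μ + 1) ⟨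
  windowExponent μ + (μ + 1) ∸ (μ + 1)     ≡⟨ cong (_∸ (μ + 1)) (windowExponent+μ+1≡2^μ μ) ⟩
  2 ^ μ ∸ (μ + 1)                          ≡⟨ ∸-+-assoc (2 ^ μ) μ 1 ⟨
  2 ^ μ ∸ μ ∸ 1                            ∎
  where open ≡-Reasoning

2^windowExponent-suc : ∀ μ →
  2 ^ windowExponent (suc μ) ≡ 2 ^ windowExponent μ * 2 ^ windowExponent μ * 2 ^ μ
2^windowExponent-suc μ rewrite ^-distribˡ-+-* 2 (windowExponent μ + windowExponent μ) μ
                             | ^-distribˡ-+-* 2 (windowExponent μ) (windowExponent μ) = refl

-- 2 ^ μ * suc q is the multiple of 2 ^ μ in the window when j' = r + q * 2 ^ μ with r < 2 ^ μ.
record DyadicProfile (μ q j' : ℕ) : Set where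
  field
    oddP oddH   : ℕ
    2∤oddP      : 2 ∤ oddP
    2∤oddH      : 2 ∤ oddH
    productSuc≡ : productSuc (window j' (2 ^ μ)) ≡ 2 ^ windowExponent μ * (2 ^ μ * suc q) * oddP
    harmNum≡    : harmNum (window j' (2 ^ μ)) ≡ 2 ^ windowExponent μ * oddH

dyadicProfile-singleton : ∀ q → DyadicProfile 0 q q
dyadicProfile-singleton q = record
  { oddP = 1 ; oddH = 1 ; 2∤oddP = 2∤1 ; 2∤oddH = 2∤1
  ; productSuc≡ = product≡ q ; harmNum≡ = harmNum≡ q }
  where
  product≡ : ∀ q → suc (q + 0) * 1 ≡ 1 * (1 * suc q) * 1
  product≡ = solve-∀
  harmNum≡ : ∀ q → 1 + suc (q + 0) * 0 ≡ 1 * 1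
  harmNum≡ = solve-∀

OneEven : ℕ → ℕ → Set
OneEven c c′ = (2 ∤ c × 2 ∣ c′) ⊎ (2 ∣ c × 2 ∤ c′)

OneEven-mix : ∀ {c c′ x y} → OneEven c c′ → 2 ∤ x → 2 ∤ y → 2 ∤ x * c′ + c * y
OneEven-mix {x = x} (inj₁ (2∤c , 2∣c′)) _ 2∤y =
  ∣-+-∤ (∣n⇒∣m*n x 2∣c′) (prime-∤-* prime[2] 2∤c 2∤y)
OneEven-mix {y = y} (inj₂ (2∣c , 2∤c′)) 2∤x _ =
  ∤-+-∣ (prime-∤-* prime[2] 2∤x 2∤c′) (∣m⇒∣m*n y 2∣c)

consecutive-cofactors : ∀ Q {q} → q ≡ 2 * Q ⊎ q ≡ suc (2 * Q) →
  Σ[ o ∈ ℕ ] 2 ∤ o × suc q * suc (suc q) ≡ 2 * suc Q * o × OneEven (suc q) (suc (suc q))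
consecutive-cofactors Q (inj₁ refl) =
  suc (2 * Q) , 2∤2n+1 Q , product≡ Q , inj₁ (2∤2n+1 Q , 2∣2n+2 Q)
  where
  product≡ : ∀ Q → suc (2 * Q) * suc (suc (2 * Q)) ≡ 2 * suc Q * suc (2 * Q)
  product≡ = solve-∀
consecutive-cofactors Q (inj₂ refl) =
  suc (suc (suc (2 * Q))) , 2∤odd , product≡ Q , inj₂ (2∣2n+2 Q , 2∤odd)
  where
  product≡ : ∀ Q → suc (suc (2 * Q)) * suc (suc (suc (2 * Q))) ≡ 2 * suc Q * suc (suc (suc (2 * Q)))
  product≡ = solve-∀
  odd≡ : ∀ Q → suc (2 * suc Q) ≡ suc (suc (suc (2 * Q)))
  odd≡ = solve-∀
  2∤odd : 2 ∤ suc (suc (suc (2 * Q)))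
  2∤odd = subst (2 ∤_) (odd≡ Q) (2∤2n+1 (suc Q))

merge : ∀ {μ Q q j'} → q ≡ 2 * Q ⊎ q ≡ suc (2 * Q) →
        DyadicProfile μ q j' → DyadicProfile μ (suc q) (j' + 2 ^ μ) → DyadicProfile (suc μ) Q j'
merge {μ} {Q} {q} {j'} half A B with consecutive-cofactors Q half
... | o , 2∤o , c*c′≡ , oneEven = record
  { oddP = oddP′
  ; oddH = oddH′
  ; 2∤oddP = prime-∤-* prime[2] 2∤o (prime-∤-* prime[2] A.2∤oddP B.2∤oddP)
  ; 2∤oddH = OneEven-mix oneEven (prime-∤-* prime[2] A.2∤oddH B.2∤oddP)
                                 (prime-∤-* prime[2] A.2∤oddP B.2∤oddH)
  ; productSuc≡ = productSuc≡
  ; harmNum≡ = harmNum≡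
  }
  where
  module A = DyadicProfile A
  module B = DyadicProfile B
  open ≡-Reasoning
  p T T′ c c′ oddP′ oddH′ : ℕ
  p = 2 ^ μ
  T = 2 ^ windowExponent μ
  T′ = 2 ^ windowExponent (suc μ)
  c = suc q
  c′ = suc c
  oddP′ = o * (A.oddP * B.oddP)
  oddH′ = A.oddH * B.oddP * c′ + c * (A.oddP * B.oddH)
  wa wb : List ℕ
  wa = window j' p
  wb = window (j' + p) p

  productSuc≡ : productSuc (window j' (2 * p)) ≡ T′ * (2 * p * suc Q) * oddP′
  productSuc≡ = begin
    productSuc (window j' (2 * p))                  ≡⟨ cong productSuc (window-double j' p) ⟩
    productSuc (wa ++ wb)                           ≡⟨ productSuc-++ wa wb ⟩
    productSuc wa * productSuc wb                   ≡⟨ cong₂ _*_ A.productSuc≡ B.productSuc≡ ⟩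
    T * (p * c) * A.oddP * (T * (p * c′) * B.oddP)  ≡⟨ regroup T p c c′ A.oddP B.oddP ⟩
    T * T * p * (p * (c * c′)) * (A.oddP * B.oddP)  ≡⟨ cong₂ (λ t s → t * (p * s) * (A.oddP * B.oddP))
                                                             (sym (2^windowExponent-suc μ)) c*c′≡ ⟩
    T′ * (p * (2 * suc Q * o)) * (A.oddP * B.oddP)  ≡⟨ regroup′ T′ p (suc Q) o (A.oddP * B.oddP) ⟩
    T′ * (2 * p * suc Q) * oddP′                    ∎
    where
    regroup : ∀ T p c c′ u v →
              T * (p * c) * u * (T * (p * c′) * v) ≡ T * T * p * (p * (c * c′)) * (u * v)
    regroup = solve-∀
    regroup′ : ∀ T′ p s o u → T′ * (p * (2 * s * o)) * u ≡ T′ * (2 * p * s) * (o * u)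
    regroup′ = solve-∀

  harmNum≡ : harmNum (window j' (2 * p)) ≡ T′ * oddH′
  harmNum≡ = begin
    harmNum (window j' (2 * p))                              ≡⟨ cong harmNum (window-double j' p) ⟩
    harmNum (wa ++ wb)                                       ≡⟨ harmNum-++ wa wb ⟩
    harmNum wa * productSuc wb + productSuc wa * harmNum wb
      ≡⟨ cong₂ _+_ (cong₂ _*_ A.harmNum≡ B.productSuc≡) (cong₂ _*_ A.productSuc≡ B.harmNum≡) ⟩
    T * A.oddH * (T * (p * c′) * B.oddP) + T * (p * c) * A.oddP * (T * B.oddH)
      ≡⟨ factor T p c c′ A.oddH A.oddP B.oddH B.oddP ⟩
    T * T * p * oddH′                                        ≡⟨ cong (_* oddH′) (2^windowExponent-suc μ) ⟨
    T′ * oddH′                                               ∎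
    where
    factor : ∀ T p c c′ h u h′ u′ →
             T * h * (T * (p * c′) * u′) + T * (p * c) * u * (T * h′)
             ≡ T * T * p * (h * u′ * c′ + c * (u * h′))
    factor = solve-∀

halve-remainder : ∀ p Q R → R < 2 * p →
  Σ[ q ∈ ℕ ] Σ[ r ∈ ℕ ] r < p × R + Q * (2 * p) ≡ r + q * p × (q ≡ 2 * Q ⊎ q ≡ suc (2 * Q))
halve-remainder p Q R R<2p with R <? p
... | yes R<p = 2 * Q , R , R<p , cong (_+_ R) (*-comm-2 Q p) , inj₁ refl
  where
  *-comm-2 : ∀ Q p → Q * (2 * p) ≡ 2 * Q * p
  *-comm-2 = solve-∀
... | no R≮p with m≤n⇒∃[o]m+o≡n (≮⇒≥ R≮p)
...   | r , refl = suc (2 * Q) , r , r<p , regroup p Q r , inj₂ refl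
  where
  r<p : r < p
  r<p = +-cancelˡ-< p r p (subst (λ t → p + r < p + t) (+-identityʳ p) R<2p)
  regroup : ∀ p Q r → p + r + Q * (2 * p) ≡ r + suc (2 * Q) * p
  regroup = solve-∀

dyadicProfile : ∀ μ {q r j'} → r < 2 ^ μ → j' ≡ r + q * 2 ^ μ → DyadicProfile μ q j'
dyadicProfile zero    {q} {zero}  _ j'≡ =
  subst (DyadicProfile 0 q) (sym (trans j'≡ (*-identityʳ q))) (dyadicProfile-singleton q)
dyadicProfile zero    {r = suc r} (s≤s ())
dyadicProfile (suc μ) {Q} {R} {j'} R< j'≡ with halve-remainder (2 ^ μ) Q R R<
... | q , r , r< , R+Q*2p≡ , half =
  merge half (dyadicProfile μ r< j'≡r+qp) (dyadicProfile μ r< j'+p≡r+[q+1]p)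
  where
  j'≡r+qp : j' ≡ r + q * 2 ^ μ
  j'≡r+qp = trans j'≡ R+Q*2p≡
  shift : ∀ r q p → r + q * p + p ≡ r + suc q * p
  shift = solve-∀
  j'+p≡r+[q+1]p : j' + 2 ^ μ ≡ r + suc q * 2 ^ μ
  j'+p≡r+[q+1]p = trans (cong (_+ 2 ^ μ) j'≡r+qp) (shift r q (2 ^ μ))

harmNum-window-Val2≡ : ∀ μ j' → Val2≡ (harmNum (window j' (2 ^ μ))) (windowExponent μ)
harmNum-window-Val2≡ μ j' =
  subst (λ n → Val2≡ n (windowExponent μ)) (sym harmNum≡) (Val2≡-2^v*odd (windowExponent μ) 2∤oddH)
  where
  instance
    2^μ≢0 : NonZero (2 ^ μ)
    2^μ≢0 = m^n≢0 2 μ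
  open DyadicProfile
    (dyadicProfile μ {q = j' div 2 ^ μ} (m%n<n j' (2 ^ μ)) (m≡m%n+[m/n]*n j' (2 ^ μ)))

lemma3p3 : (μ : ℕ) → μ ≥ 1 → (j' : ℕ) →
    Σ ℕ (λ N → (Q-quantity j' (2 ^ μ) ≃ ((+ N) / 1)) × Val2≡ N ((2 ^ μ) ∸ μ ∸ 1))
lemma3p3 μ _ j' =
  harmNum w ,
  ≃-trans (≃-reflexive (Q-quantity≡ j' (2 ^ μ))) (prodQ*harmQ≃harmNum w) ,
  subst (Val2≡ (harmNum w)) (windowExponent≡2^μ∸μ∸1 μ) (harmNum-window-Val2≡ μ j')
  where
  w : List ℕ
  w = window j' (2 ^ μ)
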